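{- Let $k\ge1$ and let $S_k=K_{1,k}$ be the star graph with center $c$ and $k$ leaves. Then $n(S_k)=2\cdot k!$. Furthermore, every word $w$ of minimum length $\ell(S_k)$ that word-represents $S_k$ has, for some labeling $u_1,\dots,u_k$ of the leaves, one of the forms $$w=u_k\,u_1u_2\cdots u_{k-1}\,c\,u_{k-1}u_{k-2}\cdots u_1\qquad\text{or}\qquad w=u_1u_2\cdots u_{k-1}\,c\,u_{k-1}u_{k-2}\cdots u_1\,u_k.$$
   Context: A word $w$ over the alphabet $V$ word-represents a graph $G=(V,E)$ if $w$ contains every letter of $V$ at least once and for all distinct $x,y\in V$, $xy\in E$ if and only if $x$ and $y$ alternate in $w$ (the subword of $w$ consisting only of occurrences of $x$ and $y$ has no two equal consecutive letters). $\ell(G)$ is the minimum length of a word that word-represents $G$, and $n(G)$ is the number of words of length $\ell(G)$ that word-represent $G$. -}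

module Defs where

open import Data.Nat using (ℕ; zero; suc; _≤_; _*_; _!)
open import Data.Fin using (Fin; zero; suc; inject₁; fromℕ; _≟_)
open import Data.List using (List; []; _∷_; _++_; [_]; map; filter; reverse; length; allFin)
open import Data.List.Membership.Propositional using (_∈_)
open import Data.List.Relation.Unary.Linked using (Linked)
open import Data.List.Relation.Unary.Unique.Propositional using (Unique)
open import Data.Product using (Σ; ∃; _×_; _,_)
open import Data.Sum using (_⊎_)
open import Relation.Binary.PropositionalEquality using (_≡_; _≢_)
open import Relation.Nullary.Decidable using (_⊎-dec_)
open import Function.Bundles using (_⇔_)
open import Function.Definitions using (Injective)

Graph : ℕ → Set₁
Graph n = Fin n → Fin n → Set

Word : ℕ → Set
Word n = List (Fin n)

restrict : {n : ℕ} → Fin n → Fin n → Word n → Word n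
restrict x y w = filter (λ z → (z ≟ x) ⊎-dec (z ≟ y)) w

Alternate : {n : ℕ} → Fin n → Fin n → Word n → Set
Alternate x y w = Linked _≢_ (restrict x y w)

WordRepresents : {n : ℕ} → Graph n → Word n → Set
WordRepresents {n} G w =
  ((x : Fin n) → x ∈ w) ×
  ((x y : Fin n) → x ≢ y → (G x y ⇔ Alternate x y w))

IsMinLength : {n : ℕ} → Graph n → ℕ → Set
IsMinLength G m =
  (∃ λ w → length w ≡ m × WordRepresents G w) ×
  (∀ w → WordRepresents G w → m ≤ length w)

NumRepresentingWords : {n : ℕ} → Graph n → ℕ → ℕ → Set
NumRepresentingWords {n} G m N =
  Σ (List (Word n)) λ L →
    Unique L × length L ≡ N ×
    (∀ w → (w ∈ L ⇔ (length w ≡ m × WordRepresents G w)))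

-- Star graph S_k = K_{1,k} on Fin (suc k): center `zero`, leaves `suc i`.
center : {k : ℕ} → Fin (suc k)
center = zero

StarEdge : (k : ℕ) → Graph (suc k)
StarEdge k x y = (x ≡ center × y ≢ center) ⊎ (y ≡ center × x ≢ center)

-- A labeling u_1,…,u_k of the leaves of S_k (here k = suc j): an injective
-- map σ : Fin k → Fin k, u_i = suc (σ i) (i.e. a bijection onto the leaves).
-- u_1 … u_{k-1}
leafPrefix : (j : ℕ) → (Fin (suc j) → Fin (suc j)) → Word (suc (suc j))
leafPrefix j σ = map (λ i → suc (σ (inject₁ i))) (allFin j)

lastLeaf : (j : ℕ) → (Fin (suc j) → Fin (suc j)) → Fin (suc (suc j))
lastLeaf j σ = suc (σ (fromℕ j))

form₁ : (j : ℕ) → (Fin (suc j) → Fin (suc j)) → Word (suc (suc j))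
form₁ j σ = lastLeaf j σ ∷ (leafPrefix j σ ++ (center ∷ reverse (leafPrefix j σ)))

form₂ : (j : ℕ) → (Fin (suc j) → Fin (suc j)) → Word (suc (suc j))
form₂ j σ = leafPrefix j σ ++ (center ∷ reverse (leafPrefix j σ)) ++ [ lastLeaf j σ ]

module Submission where

-- Call w a star word over a duplicate-free list L of leaves (center c) if c and the leaves occur
-- in w, each leaf alternates with c and no two leaves alternate. Letters occurring at most once
-- alternate, so of two leaves one occurs twice; erasing it leaves a star word over the others.
-- Induction gives |w| ≥ 2|L| (star-length), and when |w| = 2|L| the erased leaf occurs exactly
-- twice. With nest (a₁ … aₘ) = a₁ … aₘ c aₘ … a₁, re-inserting that leaf (insert-nest,
-- insert-border₁/₂) shows along the same induction that a star word of length 2|L| is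
-- b ∷ nest p or nest p ++ [ b ] for an arrangement b ∷ p of L (shortest-shape); conversely these
-- words are star words (NestedStar). The words representing S_k are exactly the star words over
-- its leaves, so its shortest words are listed without repetition as two words per arrangement of
-- the leaves (module Arrangements enumerates the k! arrangements), and reading b ∷ p as the
-- labeling u₁ … uₖ₋₁ = p, uₖ = b gives the two forms of the statement (module Star).

open import Defs
open import Data.Nat using (ℕ; zero; suc; _+_; _*_; _!; _≤_; z≤n; s≤s)
open import Data.Nat.Properties using (+-suc; +-comm; suc-injective; ≤-trans; ≤-pred; n≤1+n; ≰⇒>; <⇒≱; +-mono-≤; +-monoʳ-≤; +-cancelʳ-≤; +-cancelˡ-≡; ≤-antisym; *-comm; ≤-refl; _≤?_)
open import Data.Fin using (Fin; zero; suc; _≟_; inject₁; fromℕ)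
import Data.Fin.Properties
open import Data.List using (List; []; _∷_; _++_; [_]; filter; length; replicate; reverse; map; concatMap; allFin; tabulate)
open import Data.List.Properties using (map-∘; ++-conicalʳ; filter-accept; filter-reject; filter-++; filter-some; length-++; ++-assoc; ++-identityʳ; unfold-reverse; reverse-++; ∷-injective; ∷ʳ-injective; ∷ʳ-injectiveˡ; length-map; length-reverse; length-tabulate; map-tabulate)
open import Data.List.Membership.Propositional using (_∈_; _∉_; find)
open import Data.List.Membership.Propositional.Properties using (∈-filter⁺; ∈-filter⁻; ∈-++⁺ˡ; ∈-++⁺ʳ; ∈-++⁻; ∈-map⁺; ∈-map⁻; ∈-concatMap⁺; ∈-concatMap⁻; ∈-allFin)
open import Data.List.Relation.Binary.Subset.Propositional using (_⊆_)
open import Data.List.Relation.Unary.Any using (here; there)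
import Data.List.Relation.Unary.Any as Any
open import Data.List.Relation.Unary.All using (All; []; _∷_)
import Data.List.Relation.Unary.All as All
open import Data.List.Relation.Unary.All.Properties using (¬Any⇒All¬)
open import Data.List.Relation.Unary.AllPairs using ([]; _∷_)
import Data.List.Relation.Unary.AllPairs as AllPairs
open import Data.List.Relation.Unary.Linked using (Linked; []; [-]; _∷_)
import Data.List.Relation.Unary.Linked as Linked
open import Data.List.Reverse using (reverseView; _∶_∶ʳ_)
open import Data.List.Relation.Unary.Linked.Properties using (AllPairs⇒Linked)
open import Data.List.Relation.Unary.Unique.Propositional using (Unique)
open import Data.List.Relation.Unary.Unique.Propositional.Properties using (Unique[x∷xs]⇒x∉xs; ++⁺; map⁺; map⁻; allFin⁺)
open import Data.Product using (Σ; _×_; _,_; proj₁; proj₂)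
open import Data.Sum using (_⊎_; inj₁; inj₂; map₂)
open import Data.Empty using (⊥; ⊥-elim)
open import Relation.Nullary using (¬_; yes; no)
open import Relation.Nullary.Decidable using (¬?; _⊎-dec_)
open import Relation.Binary.PropositionalEquality using (_≡_; _≢_; refl; sym; trans; cong; cong₂; subst; ≢-sym; module ≡-Reasoning)
open import Function.Base using (id; _∘_)
open import Function.Definitions using (Injective)
open import Function.Bundles using (_⇔_; mk⇔; Equivalence)

¬linked-repeat : ∀ {A : Set} (xs : List A) {a : A} ys → ¬ Linked _≢_ (xs ++ a ∷ a ∷ ys)
¬linked-repeat []       ys (a≢a ∷ _) = a≢a refl
¬linked-repeat (x ∷ xs) ys l         = ¬linked-repeat xs ys (Linked.tail l)

-- A list of the form pre ++ r ++ reverse r ++ post with r nonempty repeats the last letter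
-- of r, hence is not ≢-linked.
¬linked-mirror : ∀ {A : Set} {v : A} pre r post → v ∈ r → ¬ Linked _≢_ (pre ++ (r ++ (reverse r ++ post)))
¬linked-mirror pre r post v∈r with reverseView r
... | s ∶ _ ∶ʳ a = ¬linked-repeat (pre ++ s) (reverse s ++ post) ∘ subst (Linked _≢_) mirror
  where
  open ≡-Reasoning
  mirror : pre ++ ((s ++ [ a ]) ++ (reverse (s ++ [ a ]) ++ post)) ≡ (pre ++ s) ++ a ∷ a ∷ (reverse s ++ post)
  mirror = begin
    pre ++ ((s ++ [ a ]) ++ (reverse (s ++ [ a ]) ++ post))
      ≡⟨ cong (λ u → pre ++ ((s ++ [ a ]) ++ (u ++ post))) (reverse-++ s [ a ]) ⟩
    pre ++ ((s ++ [ a ]) ++ (a ∷ reverse s ++ post))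
      ≡⟨ cong (pre ++_) (++-assoc s [ a ] _) ⟩
    pre ++ (s ++ a ∷ a ∷ (reverse s ++ post))
      ≡⟨ sym (++-assoc pre s _) ⟩
    (pre ++ s) ++ a ∷ a ∷ (reverse s ++ post) ∎

∈⇒nonempty : ∀ {A : Set} {v : A} {xs} → v ∈ xs → 1 ≤ length xs
∈⇒nonempty (here _)  = s≤s z≤n
∈⇒nonempty (there _) = s≤s z≤n

-- Non-membership as a pointwise statement, the form in which Unique is built.
∉⇒All≢ : ∀ {A : Set} {x : A} {xs} → x ∉ xs → All (x ≢_) xs
∉⇒All≢ = ¬Any⇒All¬ _

SameSet : ∀ {A : Set} → List A → List A → Set
SameSet p q = p ⊆ q × q ⊆ p

module _ {n : ℕ} where

  erase : Fin n → Word n → Word n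
  erase z = filter (λ a → ¬? (a ≟ z))

  occ : Fin n → Word n → ℕ
  occ z w = length (filter (_≟ z) w)

  erase-≢ : ∀ {z a} w → a ≢ z → erase z (a ∷ w) ≡ a ∷ erase z w
  erase-≢ {z} w a≢z = filter-accept (λ a → ¬? (a ≟ z)) a≢z

  erase-≡ : ∀ z w → erase z (z ∷ w) ≡ erase z w
  erase-≡ z w = filter-reject (λ a → ¬? (a ≟ z)) (λ z≢z → z≢z refl)

  occ-≢ : ∀ {z a} w → a ≢ z → occ z (a ∷ w) ≡ occ z w
  occ-≢ {z} w a≢z = cong length (filter-reject (_≟ z) a≢z)

  occ-++ : ∀ z u v → occ z (u ++ v) ≡ occ z u + occ z v
  occ-++ z u v = trans (cong length (filter-++ (_≟ z) u v)) (length-++ (filter (_≟ z) u))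

  occ-replicate : ∀ z k → occ z (replicate k z) ≡ k
  occ-replicate z zero    = refl
  occ-replicate z (suc k) with z ≟ z
  ... | yes _  = cong suc (occ-replicate z k)
  ... | no z≢z = ⊥-elim (z≢z refl)

  occ-padˡ : ∀ z a k v → a ≢ z → occ z (replicate k z ++ a ∷ v) ≡ k + occ z v
  occ-padˡ z a k v a≢z = trans (occ-++ z (replicate k z) _) (cong₂ _+_ (occ-replicate z k) (occ-≢ v a≢z))

  occ-padʳ : ∀ z a v k → a ≢ z → occ z (v ++ a ∷ replicate k z) ≡ occ z v + k
  occ-padʳ z a v k a≢z = trans (occ-++ z v _) (cong (occ z v +_) (trans (occ-≢ _ a≢z) (occ-replicate z k)))

  ∈⇒occ : ∀ {z w} → z ∈ w → 1 ≤ occ z w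
  ∈⇒occ {z} z∈w = filter-some (_≟ z) (Any.map sym z∈w)

  length-erase-occ : ∀ z w → length w ≡ length (erase z w) + occ z w
  length-erase-occ z []      = refl
  length-erase-occ z (a ∷ w) with a ≟ z
  ... | yes _ = trans (cong suc (length-erase-occ z w)) (sym (+-suc _ _))
  ... | no _  = cong suc (length-erase-occ z w)

  erase≡[] : ∀ z w → erase z w ≡ [] → Σ ℕ λ k → w ≡ replicate k z
  erase≡[] z []      _ = 0 , refl
  erase≡[] z (a ∷ w) e with a ≟ z
  erase≡[] z (a ∷ w) e  | yes refl = let k , w≡ = erase≡[] a w e in suc k , cong (a ∷_) w≡
  erase≡[] z (a ∷ w) () | no _

  occ≡0⇒erase≡ : ∀ z w → occ z w ≡ 0 → erase z w ≡ w
  occ≡0⇒erase≡ z []      _ = refl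
  occ≡0⇒erase≡ z (a ∷ w) e with a ≟ z
  ... | no _ = cong (a ∷_) (occ≡0⇒erase≡ z w e)

  erase≡∷ : ∀ z a v w → erase z w ≡ a ∷ v →
    Σ ℕ λ k → Σ (Word n) λ w₁ → w ≡ replicate k z ++ a ∷ w₁ × erase z w₁ ≡ v
  erase≡∷ z a v (b ∷ w) e with b ≟ z
  ... | yes refl = let k , w₁ , w≡ , e′ = erase≡∷ b a v w e in suc k , w₁ , cong (b ∷_) w≡ , e′
  erase≡∷ z a v (b ∷ w) refl | no _ = 0 , w , refl , refl

  erase≡∷ʳ : ∀ z a v w → erase z w ≡ v ++ [ a ] →
    Σ (Word n) λ w₂ → Σ ℕ λ k → w ≡ w₂ ++ a ∷ replicate k z × erase z w₂ ≡ v
  erase≡∷ʳ z a []      []      ()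
  erase≡∷ʳ z a (_ ∷ _) []      ()
  erase≡∷ʳ z a v       (b ∷ w) e with b ≟ z
  ... | yes refl = let w₂ , k , w≡ , e′ = erase≡∷ʳ b a v w e in b ∷ w₂ , k , cong (b ∷_) w≡ , trans (erase-≡ b w₂) e′
  erase≡∷ʳ z a []      (b ∷ w) e | no _ with refl , e′ ← ∷-injective e =
    let k , w≡ = erase≡[] z w e′ in [] , k , cong (b ∷_) w≡ , refl
  erase≡∷ʳ z a (_ ∷ v) (b ∷ w) e | no b≢z with refl , e′ ← ∷-injective e =
    let w₂ , k , w≡ , e″ = erase≡∷ʳ z a v w e′
    in b ∷ w₂ , k , cong (b ∷_) w≡ , trans (erase-≢ w₂ b≢z) (cong (b ∷_) e″)

  restrict-≡ˡ : ∀ (x y : Fin n) w → restrict x y (x ∷ w) ≡ x ∷ restrict x y w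
  restrict-≡ˡ x y w = filter-accept (λ a → (a ≟ x) ⊎-dec (a ≟ y)) (inj₁ refl)

  restrict-≡ʳ : ∀ (x y : Fin n) w → restrict x y (y ∷ w) ≡ y ∷ restrict x y w
  restrict-≡ʳ x y w = filter-accept (λ a → (a ≟ x) ⊎-dec (a ≟ y)) (inj₂ refl)

  restrict-≢ : ∀ {x y a : Fin n} w → a ≢ x → a ≢ y → restrict x y (a ∷ w) ≡ restrict x y w
  restrict-≢ {x} {y} w a≢x a≢y =
    filter-reject (λ a → (a ≟ x) ⊎-dec (a ≟ y)) (λ { (inj₁ e) → a≢x e ; (inj₂ e) → a≢y e })

  restrict-++ : ∀ (x y : Fin n) u v → restrict x y (u ++ v) ≡ restrict x y u ++ restrict x y v
  restrict-++ x y = filter-++ (λ a → (a ≟ x) ⊎-dec (a ≟ y))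

  restrict-comm : ∀ (x y : Fin n) w → restrict x y w ≡ restrict y x w
  restrict-comm x y []      = refl
  restrict-comm x y (a ∷ w) with a ≟ x | a ≟ y
  ... | yes _ | yes _ = cong (a ∷_) (restrict-comm x y w)
  ... | yes _ | no _  = cong (a ∷_) (restrict-comm x y w)
  ... | no _  | yes _ = cong (a ∷_) (restrict-comm x y w)
  ... | no _  | no _  = restrict-comm x y w

  restrict-erase : ∀ (x y z : Fin n) w → x ≢ z → y ≢ z → restrict x y (erase z w) ≡ restrict x y w
  restrict-erase x y z []      _   _   = refl
  restrict-erase x y z (a ∷ w) x≢z y≢z with a ≟ z
  ... | yes refl = trans (restrict-erase x y a w x≢z y≢z) (sym (restrict-≢ w (≢-sym x≢z) (≢-sym y≢z)))
  ... | no _ with a ≟ x | a ≟ y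
  ...   | yes _ | _     = cong (a ∷_) (restrict-erase x y z w x≢z y≢z)
  ...   | no _  | yes _ = cong (a ∷_) (restrict-erase x y z w x≢z y≢z)
  ...   | no _  | no _  = restrict-erase x y z w x≢z y≢z

  restrict-wrap : ∀ {x y a : Fin n} u → a ≢ x → a ≢ y → restrict x y (a ∷ (u ++ [ a ])) ≡ restrict x y u
  restrict-wrap {x} {y} {a} u a≢x a≢y = begin
    restrict x y (a ∷ (u ++ [ a ]))         ≡⟨ restrict-≢ (u ++ [ a ]) a≢x a≢y ⟩
    restrict x y (u ++ [ a ])               ≡⟨ restrict-++ x y u [ a ] ⟩
    restrict x y u ++ restrict x y [ a ]    ≡⟨ cong (restrict x y u ++_) (restrict-≢ [] a≢x a≢y) ⟩
    restrict x y u ++ []                    ≡⟨ ++-identityʳ _ ⟩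
    restrict x y u                          ∎
    where open ≡-Reasoning

  restrict-replicate : ∀ (x y : Fin n) k → restrict x y (replicate k x) ≡ replicate k x
  restrict-replicate x y zero    = refl
  restrict-replicate x y (suc k) = trans (restrict-≡ˡ x y _) (cong (x ∷_) (restrict-replicate x y k))

  restrict-padˡ : ∀ (x y : Fin n) k v → restrict x y (replicate k x ++ v) ≡ replicate k x ++ restrict x y v
  restrict-padˡ x y k v = trans (restrict-++ x y (replicate k x) v) (cong (_++ restrict x y v) (restrict-replicate x y k))

  restrict-only : ∀ (z a : Fin n) w → a ∉ erase z w → restrict z a w ≡ replicate (occ z w) z
  restrict-only z a []      _   = refl
  restrict-only z a (b ∷ w) a∉ with b ≟ z
  ... | yes refl = cong (b ∷_) (restrict-only b a w a∉)
  ... | no _ with b ≟ a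
  ...   | yes refl = ⊥-elim (a∉ (here refl))
  ...   | no _     = restrict-only z a w (λ a∈ → a∉ (there a∈))

  occ-tail : ∀ z a w → occ z w ≤ occ z (a ∷ w)
  occ-tail z a w with a ≟ z
  ... | yes _ = n≤1+n _
  ... | no _  = ≤-refl

  occ≤0⇒∉ : ∀ {a : Fin n} w → occ a w ≤ 0 → a ∉ w
  occ≤0⇒∉ w o a∈ = <⇒≱ (∈⇒occ a∈) o

  ∉-restrict : ∀ {a : Fin n} x y w → a ∉ w → a ∉ restrict x y w
  ∉-restrict x y w a∉ a∈ = a∉ (proj₁ (∈-filter⁻ (λ b → (b ≟ x) ⊎-dec (b ≟ y)) a∈))

  rare⇒unique : ∀ (x y : Fin n) w → occ x w ≤ 1 → occ y w ≤ 1 → Unique (restrict x y w)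
  rare⇒unique x y []      _  _  = []
  rare⇒unique x y (a ∷ w) ox oy with a ≟ x
  ... | yes refl = ∉⇒All≢ (∉-restrict a y w (occ≤0⇒∉ w (≤-pred ox))) ∷
                   rare⇒unique a y w (≤-trans (n≤1+n _) ox) (≤-trans (occ-tail y a w) oy)
  ... | no a≢x with a ≟ y
  ...   | yes refl = ∉⇒All≢ (∉-restrict x a w (occ≤0⇒∉ w (≤-pred oy))) ∷
                     rare⇒unique x a w ox (≤-trans (n≤1+n _) oy)
  ...   | no a≢y   = rare⇒unique x y w ox oy

  data RestrictCons (x y a : Fin n) : Set where
    kept    : (∀ u → restrict x y (a ∷ u) ≡ a ∷ restrict x y u) → RestrictCons x y a
    dropped : a ≢ x → a ≢ y → RestrictCons x y a

  restrict-cons : ∀ x y a → RestrictCons x y a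
  restrict-cons x y a with a ≟ x | a ≟ y
  ... | yes refl | _        = kept (restrict-≡ˡ a y)
  ... | no _     | yes refl = kept (restrict-≡ʳ x a)
  ... | no a≢x   | no a≢y   = dropped a≢x a≢y

  nonalternating⇒twice : ∀ (x y : Fin n) w → ¬ Alternate x y w → 2 ≤ occ x w ⊎ 2 ≤ occ y w
  nonalternating⇒twice x y w ¬alt with 2 ≤? occ x w | 2 ≤? occ y w
  ... | yes x-twice | _           = inj₁ x-twice
  ... | no _        | yes y-twice = inj₂ y-twice
  ... | no ¬x-twice | no ¬y-twice =
    ⊥-elim (¬alt (AllPairs⇒Linked (rare⇒unique x y w (≤-pred (≰⇒> ¬x-twice)) (≤-pred (≰⇒> ¬y-twice)))))

-- Arithmetic for the length bound 2m and its equality case.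
double-suc : ∀ a → suc a + suc a ≡ a + a + 2
double-suc a = trans (cong suc (+-suc a a)) (+-comm 2 (a + a))

double-step : ∀ a b d → a + a ≤ b → 2 ≤ d → suc a + suc a ≤ b + d
double-step a b d a+a≤b 2≤d = subst (_≤ b + d) (sym (double-suc a)) (+-mono-≤ a+a≤b 2≤d)

double-tight : ∀ S a d → a + d ≡ S + 2 → S ≤ a → 2 ≤ d → a ≡ S × d ≡ 2
double-tight S a d sum S≤a 2≤d = a≡S , +-cancelˡ-≡ S d 2 (trans (cong (_+ d) (sym a≡S)) sum)
  where
  a≡S : a ≡ S
  a≡S = ≤-antisym (+-cancelʳ-≤ 2 a S (subst (a + 2 ≤_) sum (+-monoʳ-≤ a 2≤d))) S≤a

module StarWords {n : ℕ} (c : Fin n) where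

  record StarWord (L w : Word n) : Set where
    field
      leaves-unique         : Unique L
      center∉leaves         : c ∉ L
      center∈word           : c ∈ w
      leaves⊆word           : L ⊆ w
      leaf-alternates       : ∀ {x} → x ∈ L → Alternate x c w
      leaves-nonalternating : ∀ {x y} → x ∈ L → y ∈ L → x ≢ y → ¬ Alternate x y w
  open StarWord public

  erase-leaf : ∀ {L L′ z w} → StarWord L w → z ∈ L → Unique L′ → L′ ⊆ L → (∀ {y} → y ∈ L′ → y ≢ z) →
    StarWord L′ (erase z w)
  erase-leaf {L} {L′} {z} {w} st z∈L uL′ L′⊆L L′≢z = record
    { leaves-unique         = uL′
    ; center∉leaves         = λ c∈L′ → center∉leaves st (L′⊆L c∈L′)
    ; center∈word           = survives (center∈word st) c≢z
    ; leaves⊆word           = λ x∈L′ → survives (leaves⊆word st (L′⊆L x∈L′)) (L′≢z x∈L′)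
    ; leaf-alternates       = λ {x} x∈L′ →
        subst (Linked _≢_) (sym (restrict-erase x c z w (L′≢z x∈L′) c≢z)) (leaf-alternates st (L′⊆L x∈L′))
    ; leaves-nonalternating = λ {x} {y} x∈L′ y∈L′ x≢y alt → leaves-nonalternating st (L′⊆L x∈L′) (L′⊆L y∈L′) x≢y
        (subst (Linked _≢_) (restrict-erase x y z w (L′≢z x∈L′) (L′≢z y∈L′)) alt)
    }
    where
    survives : ∀ {x} → x ∈ w → x ≢ z → x ∈ erase z w
    survives = ∈-filter⁺ (λ a → ¬? (a ≟ z))
    c≢z : c ≢ z
    c≢z refl = center∉leaves st z∈L

  record Reduction (L w : Word n) : Set where
    field
      z           : Fin n
      rest        : Word n
      z∈L         : z ∈ L
      z-twice     : 2 ≤ occ z w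
      rest-length : suc (length rest) ≡ length L
      rest-star   : StarWord rest (erase z w)
      rest⊆L      : rest ⊆ L
      rest≢z      : ∀ {y} → y ∈ rest → y ≢ z
      L⊆z∷rest    : L ⊆ z ∷ rest

  -- The first two leaves x, y do not alternate, so one of them occurs twice and is erased.
  reduce : ∀ x y L w → StarWord (x ∷ y ∷ L) w → Reduction (x ∷ y ∷ L) w
  reduce x y L w st with leaves-unique st
  ... | (x∉ ∷ (y∉L ∷ uL)) with nonalternating⇒twice x y w
                                 (leaves-nonalternating st (here refl) (there (here refl)) (All.head x∉))
  ... | inj₁ x-twice = record
    { z = x ; rest = y ∷ L ; z∈L = here refl ; z-twice = x-twice ; rest-length = refl
    ; rest-star = erase-leaf st (here refl) (y∉L ∷ uL) there rest≢x
    ; rest⊆L = there ; rest≢z = rest≢x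
    ; L⊆z∷rest = id
    }
    where
    rest≢x : ∀ {v} → v ∈ y ∷ L → v ≢ x
    rest≢x v∈ refl = Unique[x∷xs]⇒x∉xs (leaves-unique st) v∈
  ... | inj₂ y-twice = record
    { z = y ; rest = x ∷ L ; z∈L = there (here refl) ; z-twice = y-twice ; rest-length = refl
    ; rest-star = erase-leaf st (there (here refl)) (All.tail x∉ ∷ uL) rest⊆ rest≢y
    ; rest⊆L = rest⊆ ; rest≢z = rest≢y
    ; L⊆z∷rest = λ { (here e) → there (here e) ; (there (here e)) → here e ; (there (there v∈)) → there (there v∈) }
    }
    where
    rest⊆ : x ∷ L ⊆ x ∷ y ∷ L
    rest⊆ (here e)   = here e
    rest⊆ (there v∈) = there (there v∈)
    rest≢y : ∀ {v} → v ∈ x ∷ L → v ≢ y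
    rest≢y (here refl) refl = All.head x∉ refl
    rest≢y (there v∈)  refl = All.lookup y∉L v∈ refl

  star-length : ∀ m L w → length L ≡ m → StarWord L w → m + m ≤ length w
  star-length zero []          w refl st = z≤n
  star-length (suc zero) (x ∷ []) w refl st with center∈word st | leaves⊆word st (here refl)
  ... | here refl | here refl = ⊥-elim (center∉leaves st (here refl))
  ... | here _    | there x∈  = s≤s (∈⇒nonempty x∈)
  ... | there c∈  | _         = s≤s (∈⇒nonempty c∈)
  star-length (suc (suc m)) (x ∷ y ∷ L) w len st =
    subst (_ ≤_) (sym (length-erase-occ z w))
      (double-step (suc m) _ _ (star-length (suc m) rest (erase z w) (suc-injective (trans rest-length len)) rest-star) z-twice)
    where open Reduction (reduce x y L w st)

  nest : Word n → Word n
  nest []      = [ c ]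
  nest (a ∷ p) = a ∷ (nest p ++ [ a ])

  nest-form : ∀ p → nest p ≡ p ++ c ∷ reverse p
  nest-form []      = refl
  nest-form (a ∷ p) = cong (a ∷_) (begin
    nest p ++ [ a ]                      ≡⟨ cong (_++ [ a ]) (nest-form p) ⟩
    (p ++ c ∷ reverse p) ++ [ a ]        ≡⟨ ++-assoc p (c ∷ reverse p) [ a ] ⟩
    p ++ c ∷ (reverse p ++ [ a ])        ≡⟨ cong (λ u → p ++ c ∷ u) (sym (unfold-reverse a p)) ⟩
    p ++ c ∷ reverse (a ∷ p)             ∎)
    where open ≡-Reasoning

  length-nest : ∀ p → length (nest p) ≡ length p + suc (length p)
  length-nest p = begin
    length (nest p)                      ≡⟨ cong length (nest-form p) ⟩
    length (p ++ c ∷ reverse p)          ≡⟨ length-++ p ⟩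
    length p + suc (length (reverse p))  ≡⟨ cong (λ k → length p + suc k) (length-reverse p) ⟩
    length p + suc (length p)            ∎
    where open ≡-Reasoning

  center∈nest : ∀ p → c ∈ nest p
  center∈nest []      = here refl
  center∈nest (a ∷ p) = there (∈-++⁺ˡ (center∈nest p))

  ∈⇒∈nest : ∀ {x} p → x ∈ p → x ∈ nest p
  ∈⇒∈nest (a ∷ p) (here e)  = here e
  ∈⇒∈nest (a ∷ p) (there x∈) = there (∈-++⁺ˡ (∈⇒∈nest p x∈))

  ∈nest⇒ : ∀ {x} p → x ∈ nest p → x ≡ c ⊎ x ∈ p
  ∈nest⇒ []      (here e)  = inj₁ e
  ∈nest⇒ (a ∷ p) (here e)  = inj₂ (here e)
  ∈nest⇒ (a ∷ p) (there x∈) with ∈-++⁻ (nest p) x∈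
  ... | inj₁ x∈nest    = map₂ there (∈nest⇒ p x∈nest)
  ... | inj₂ (here e)  = inj₂ (here e)

  nest-injective : ∀ p q → nest p ≡ nest q → p ≡ q
  nest-injective []      []      _ = refl
  nest-injective []      (a ∷ q) e with () ← ++-conicalʳ (nest q) [ a ] (sym (proj₂ (∷-injective e)))
  nest-injective (a ∷ p) []      e with () ← ++-conicalʳ (nest p) [ a ] (proj₂ (∷-injective e))
  nest-injective (a ∷ p) (b ∷ q) e with refl , e′ ← ∷-injective e =
    cong (a ∷_) (nest-injective p q (∷ʳ-injectiveˡ (nest p) (nest q) e′))

  restrict-nest : ∀ x y p → x ≢ c → y ≢ c → restrict x y (nest p) ≡ restrict x y p ++ reverse (restrict x y p)
  restrict-nest x y []      x≢c y≢c = restrict-≢ [] (≢-sym x≢c) (≢-sym y≢c)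
  restrict-nest x y (a ∷ p) x≢c y≢c with restrict-cons x y a
  ... | kept r-a = begin
    restrict x y (a ∷ (nest p ++ [ a ]))           ≡⟨ r-a _ ⟩
    a ∷ restrict x y (nest p ++ [ a ])             ≡⟨ cong (a ∷_) (restrict-++ x y (nest p) [ a ]) ⟩
    a ∷ (restrict x y (nest p) ++ restrict x y [ a ])
                                                   ≡⟨ cong₂ (λ u v → a ∷ (u ++ v)) (restrict-nest x y p x≢c y≢c) (r-a []) ⟩
    a ∷ ((r ++ reverse r) ++ [ a ])                ≡⟨ cong (a ∷_) (++-assoc r (reverse r) [ a ]) ⟩
    a ∷ (r ++ (reverse r ++ [ a ]))                ≡⟨ cong (λ u → a ∷ (r ++ u)) (sym (unfold-reverse a r)) ⟩
    (a ∷ r) ++ reverse (a ∷ r)                     ≡⟨ cong (λ u → u ++ reverse u) (sym (r-a p)) ⟩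
    restrict x y (a ∷ p) ++ reverse (restrict x y (a ∷ p)) ∎
    where
    open ≡-Reasoning
    r = restrict x y p
  ... | dropped a≢x a≢y = begin
    restrict x y (a ∷ (nest p ++ [ a ]))           ≡⟨ restrict-wrap (nest p) a≢x a≢y ⟩
    restrict x y (nest p)                          ≡⟨ restrict-nest x y p x≢c y≢c ⟩
    restrict x y p ++ reverse (restrict x y p)     ≡⟨ cong (λ u → u ++ reverse u) (sym (restrict-≢ p a≢x a≢y)) ⟩
    restrict x y (a ∷ p) ++ reverse (restrict x y (a ∷ p)) ∎
    where open ≡-Reasoning

  restrict-nest-absent : ∀ x p → x ≢ c → c ∉ p → x ∉ p → restrict x c (nest p) ≡ [ c ]
  restrict-nest-absent x []      _   _  _  = restrict-≡ʳ x c []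
  restrict-nest-absent x (a ∷ p) x≢c c∉ x∉ =
    trans (restrict-wrap {a = a} (nest p) (λ { refl → x∉ (here refl) }) (λ { refl → c∉ (here refl) }))
          (restrict-nest-absent x p x≢c (c∉ ∘ there) (x∉ ∘ there))

  restrict-nest-present : ∀ x p → x ≢ c → c ∉ p → Unique p → x ∈ p → restrict x c (nest p) ≡ x ∷ c ∷ x ∷ []
  restrict-nest-present x (a ∷ p) x≢c c∉ (a∉ ∷ _) (here refl) = begin
    restrict a c (a ∷ (nest p ++ [ a ]))           ≡⟨ restrict-≡ˡ a c _ ⟩
    a ∷ restrict a c (nest p ++ [ a ])             ≡⟨ cong (a ∷_) (restrict-++ a c (nest p) [ a ]) ⟩
    a ∷ (restrict a c (nest p) ++ restrict a c [ a ])
      ≡⟨ cong₂ (λ u v → a ∷ (u ++ v)) (restrict-nest-absent a p x≢c (c∉ ∘ there) (λ a∈ → All.lookup a∉ a∈ refl))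
                                      (restrict-≡ˡ a c []) ⟩
    a ∷ c ∷ a ∷ []                                 ∎
    where open ≡-Reasoning
  restrict-nest-present x (a ∷ p) x≢c c∉ (a∉ ∷ up) (there x∈) =
    trans (restrict-wrap {a = a} (nest p) (λ { refl → All.lookup a∉ x∈ refl }) (λ { refl → c∉ (here refl) }))
          (restrict-nest-present x p x≢c (c∉ ∘ there) up x∈)

  Bordered : Fin n → Word n → Word n → Set
  Bordered b p w = w ≡ b ∷ nest p ⊎ w ≡ nest p ++ [ b ]

  Shape : Word n → Word n → Set
  Shape L w = Σ (Fin n) λ b → Σ (Word n) λ p → Unique (b ∷ p) × SameSet (b ∷ p) L × Bordered b p w

  bordered-length : ∀ b p w → Bordered b p w → length w ≡ suc (length p) + suc (length p)
  bordered-length b p _ (inj₁ refl) = cong suc (length-nest p)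
  bordered-length b p _ (inj₂ refl) = trans (length-++ (nest p)) (trans (+-comm _ 1) (cong suc (length-nest p)))

  -- The two shapes never coincide: restricted to b and c, b ∷ nest p is b c, whereas
  -- nest p′ ++ [ b′ ] starts with c, or starts with b and then contains b c b.
  bordered-distinct : ∀ b p b′ p′ → b ≢ c → c ∉ p → b ∉ p → c ∉ p′ → Unique p′ → b ∷ nest p ≢ nest p′ ++ [ b′ ]
  bordered-distinct b p b′ []       b≢c _   _   _    _   e = b≢c (proj₁ (∷-injective e))
  bordered-distinct b p b′ (a ∷ p′) b≢c c∉p b∉p c∉p′ up′ e with refl , _ ← ∷-injective e =
    2≢3+ (cong length (trans (sym short) (trans (cong (restrict b c) e) long)))
    where
    short : restrict b c (b ∷ nest p) ≡ b ∷ c ∷ []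
    short = trans (restrict-≡ˡ b c (nest p)) (cong (b ∷_) (restrict-nest-absent b p b≢c c∉p b∉p))
    long : restrict b c (nest (b ∷ p′) ++ [ b′ ]) ≡ (b ∷ c ∷ b ∷ []) ++ restrict b c [ b′ ]
    long = trans (restrict-++ b c (nest (b ∷ p′)) [ b′ ])
                 (cong (_++ restrict b c [ b′ ]) (restrict-nest-present b (b ∷ p′) b≢c c∉p′ up′ (here refl)))
    2≢3+ : ∀ {k} → 2 ≢ 3 + k
    2≢3+ ()

  module NestedStar (b : Fin n) (p : Word n) (u : Unique (b ∷ p)) (c∉ : c ∉ b ∷ p) where
    private
      leaf≢c : ∀ {x} → x ∈ b ∷ p → x ≢ c
      leaf≢c x∈ refl = c∉ x∈

      b∉p : b ∉ p
      b∉p = Unique[x∷xs]⇒x∉xs u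

      b≢ : ∀ {x} → x ∈ p → b ≢ x
      b≢ x∈ refl = b∉p x∈

      -- Two distinct leaves cannot both be b, so one of them survives in restrict x y p.
      witness : ∀ {x y} → x ∈ b ∷ p → y ∈ b ∷ p → x ≢ y → Σ (Fin n) λ v → v ∈ restrict x y p
      witness (here refl) (here refl) x≢y = ⊥-elim (x≢y refl)
      witness {x} {y} (there x∈) _ _ = x , ∈-filter⁺ (λ a → (a ≟ x) ⊎-dec (a ≟ y)) x∈ (inj₁ refl)
      witness {x} {y} (here refl) (there y∈) _ = y , ∈-filter⁺ (λ a → (a ≟ x) ⊎-dec (a ≟ y)) y∈ (inj₂ refl)

      xcx : ∀ {x} → x ≢ c → Linked _≢_ (x ∷ c ∷ x ∷ [])
      xcx x≢c = x≢c ∷ ≢-sym x≢c ∷ [-]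

    bordered₁-star : StarWord (b ∷ p) (b ∷ nest p)
    bordered₁-star = record
      { leaves-unique         = u
      ; center∉leaves         = c∉
      ; center∈word           = there (center∈nest p)
      ; leaves⊆word           = λ { (here e) → here e ; (there x∈) → there (∈⇒∈nest p x∈) }
      ; leaf-alternates       = alternates
      ; leaves-nonalternating = nonalternating
      }
      where
      alternates : ∀ {x} → x ∈ b ∷ p → Alternate x c (b ∷ nest p)
      alternates (here refl) = subst (Linked _≢_)
        (sym (trans (restrict-≡ˡ b c (nest p)) (cong (b ∷_) (restrict-nest-absent b p (leaf≢c (here refl)) (c∉ ∘ there) b∉p))))
        (leaf≢c (here refl) ∷ [-])
      alternates {x} (there x∈) = subst (Linked _≢_)
        (sym (trans (restrict-≢ (nest p) (b≢ x∈) (leaf≢c (here refl)))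
                    (restrict-nest-present x p (leaf≢c (there x∈)) (c∉ ∘ there) (AllPairs.tail u) x∈)))
        (xcx (leaf≢c (there x∈)))
      nonalternating : ∀ {x y} → x ∈ b ∷ p → y ∈ b ∷ p → x ≢ y → ¬ Alternate x y (b ∷ nest p)
      nonalternating {x} {y} x∈ y∈ x≢y =
        ¬linked-mirror (restrict x y [ b ]) (restrict x y p) [] (proj₂ (witness x∈ y∈ x≢y)) ∘ subst (Linked _≢_) split
        where
        split : restrict x y (b ∷ nest p) ≡ restrict x y [ b ] ++ (restrict x y p ++ (reverse (restrict x y p) ++ []))
        split = trans (restrict-++ x y [ b ] (nest p)) (cong (restrict x y [ b ] ++_)
                  (trans (restrict-nest x y p (leaf≢c x∈) (leaf≢c y∈)) (cong (restrict x y p ++_) (sym (++-identityʳ _)))))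

    bordered₂-star : StarWord (b ∷ p) (nest p ++ [ b ])
    bordered₂-star = record
      { leaves-unique         = u
      ; center∉leaves         = c∉
      ; center∈word           = ∈-++⁺ˡ (center∈nest p)
      ; leaves⊆word           = λ { (here e) → ∈-++⁺ʳ (nest p) (here e) ; (there x∈) → ∈-++⁺ˡ (∈⇒∈nest p x∈) }
      ; leaf-alternates       = alternates
      ; leaves-nonalternating = nonalternating
      }
      where
      alternates : ∀ {x} → x ∈ b ∷ p → Alternate x c (nest p ++ [ b ])
      alternates (here refl) = subst (Linked _≢_)
        (sym (trans (restrict-++ b c (nest p) [ b ])
                    (cong₂ _++_ (restrict-nest-absent b p (leaf≢c (here refl)) (c∉ ∘ there) b∉p) (restrict-≡ˡ b c []))))
        (≢-sym (leaf≢c (here refl)) ∷ [-])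
      alternates {x} (there x∈) = subst (Linked _≢_)
        (sym (trans (restrict-++ x c (nest p) [ b ])
               (trans (cong₂ _++_ (restrict-nest-present x p (leaf≢c (there x∈)) (c∉ ∘ there) (AllPairs.tail u) x∈)
                                  (restrict-≢ [] (b≢ x∈) (leaf≢c (here refl))))
                      (++-identityʳ _))))
        (xcx (leaf≢c (there x∈)))
      nonalternating : ∀ {x y} → x ∈ b ∷ p → y ∈ b ∷ p → x ≢ y → ¬ Alternate x y (nest p ++ [ b ])
      nonalternating {x} {y} x∈ y∈ x≢y =
        ¬linked-mirror [] (restrict x y p) (restrict x y [ b ]) (proj₂ (witness x∈ y∈ x≢y)) ∘ subst (Linked _≢_) split
        where
        split : restrict x y (nest p ++ [ b ]) ≡ restrict x y p ++ (reverse (restrict x y p) ++ restrict x y [ b ])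
        split = trans (restrict-++ x y (nest p) [ b ])
                  (trans (cong (_++ restrict x y [ b ]) (restrict-nest x y p (leaf≢c x∈) (leaf≢c y∈)))
                         (++-assoc (restrict x y p) _ _))

  Insertion : Fin n → Word n → Word n → Set
  Insertion z p q = Unique q × SameSet q (z ∷ p)

  -- If erasing z from w gives nest p, z occurs
  -- twice in w, alternates with c and with no letter of p, then w = nest q for an insertion q
  -- of z into p: the two copies of z must enclose the center and sit between the same letters.
  insert-nest : ∀ z p w → z ≢ c → z ∉ p → c ∉ p → Unique p → erase z w ≡ nest p → occ z w ≡ 2 →
    Alternate z c w → (∀ {a} → a ∈ p → ¬ Alternate z a w) →
    Σ (Word n) λ q → w ≡ nest q × Insertion z p q
  insert-nest z [] w z≢c _ _ _ e twice alt _
    with k , w₁ , refl , e₁ ← erase≡∷ z c [] w e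
    with k′ , refl ← erase≡[] z w₁ e₁
    = around k k′ count (subst (Linked _≢_) restricted alt)
    where
    c≢z : c ≢ z
    c≢z = ≢-sym z≢c
    count : k + k′ ≡ 2
    count = trans (sym (trans (occ-padˡ z c k _ c≢z) (cong (k +_) (occ-replicate z k′)))) twice
    restricted : restrict z c (replicate k z ++ c ∷ replicate k′ z) ≡ replicate k z ++ c ∷ replicate k′ z
    restricted = trans (restrict-padˡ z c k _)
      (cong (replicate k z ++_) (trans (restrict-≡ʳ z c _) (cong (c ∷_) (restrict-replicate z c k′))))
    around : ∀ k k′ → k + k′ ≡ 2 → Linked _≢_ (replicate k z ++ c ∷ replicate k′ z) →
      Σ (Word n) λ q → replicate k z ++ c ∷ replicate k′ z ≡ nest q × Insertion z [] q
    around 1 1 _ _ = [ z ] , refl , [] ∷ [] , id , id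
    around 2 0 _ l = ⊥-elim (¬linked-repeat [] [ c ] l)
    around 0 2 _ l = ⊥-elim (¬linked-repeat [ c ] [] l)
  insert-nest z (a ∷ p) w z≢c z∉ c∉ (a∉p ∷ up) e twice alt nonalt
    with k , w₁ , refl , e₁ ← erase≡∷ z a (nest p ++ [ a ]) w e
    with w₂ , k′ , refl , e₂ ← erase≡∷ʳ z a (nest p) w₁ e₁
    = wrapped k (occ z w₂) k′ refl count alt nonalt
    where
    a≢z : a ≢ z
    a≢z refl = z∉ (here refl)
    z≢a : z ≢ a
    z≢a = ≢-sym a≢z
    a≢c : a ≢ c
    a≢c refl = c∉ (here refl)
    a∉ : a ∉ erase z w₂
    a∉ a∈ with ∈nest⇒ p (subst (a ∈_) e₂ a∈)
    ... | inj₁ a≡c = a≢c a≡c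
    ... | inj₂ a∈p = All.lookup a∉p a∈p refl
    count : k + (occ z w₂ + k′) ≡ 2
    count = trans (sym (trans (occ-padˡ z a k _ a≢z) (cong (k +_) (occ-padʳ z a w₂ k′ a≢z)))) twice
    W : ℕ → ℕ → Word n
    W k k′ = replicate k z ++ a ∷ (w₂ ++ a ∷ replicate k′ z)
    -- Restricted to z and c, the letters a disappear; restricted to z and a, only z's survive in w₂.
    W-center : ∀ k k′ → restrict z c (W k k′) ≡ replicate k z ++ (restrict z c w₂ ++ replicate k′ z)
    W-center k k′ = trans (restrict-padˡ z c k _) (cong (replicate k z ++_)
      (trans (restrict-≢ _ a≢z a≢c) (trans (restrict-++ z c w₂ _)
        (cong (restrict z c w₂ ++_) (trans (restrict-≢ _ a≢z a≢c) (restrict-replicate z c k′))))))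
    W-a : ∀ k k′ → restrict z a (W k k′) ≡ replicate k z ++ a ∷ (replicate (occ z w₂) z ++ a ∷ replicate k′ z)
    W-a k k′ = trans (restrict-padˡ z a k _) (cong (replicate k z ++_)
      (trans (restrict-≡ʳ z a _) (cong (a ∷_) (trans (restrict-++ z a w₂ _)
        (cong₂ _++_ (restrict-only z a w₂ a∉) (trans (restrict-≡ʳ z a _) (cong (a ∷_) (restrict-replicate z a k′))))))))
    wrapped : ∀ k m k′ → m ≡ occ z w₂ → k + (m + k′) ≡ 2 → Alternate z c (W k k′) →
      (∀ {b} → b ∈ a ∷ p → ¬ Alternate z b (W k k′)) → Σ (Word n) λ q → W k k′ ≡ nest q × Insertion z (a ∷ p) q
    -- z encloses the outer a's: w = nest (z ∷ a ∷ p).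
    wrapped 1 0 1 m≡ _ _ _ =
      z ∷ a ∷ p ,
      cong (λ v → z ∷ a ∷ v) (trans (cong (_++ a ∷ z ∷ []) w₂≡) (sym (++-assoc (nest p) [ a ] [ z ]))) ,
      (∉⇒All≢ z∉ ∷ a∉p ∷ up) , id , id
      where
      w₂≡ : w₂ ≡ nest p
      w₂≡ = trans (sym (occ≡0⇒erase≡ z w₂ (sym m≡))) e₂
    -- z lies inside the outer a's: recurse into w₂.
    wrapped 0 2 0 m≡ _ alt nonalt
      with q , w₂≡ , uq , q⊆ , ⊆q ← insert-nest z p w₂ z≢c (z∉ ∘ there) (c∉ ∘ there) up e₂ (sym m≡)
             (subst (Linked _≢_) (restrict-wrap w₂ a≢z a≢c) alt)
             (λ {b} b∈ l → nonalt (there b∈) (subst (Linked _≢_) (sym (restrict-wrap w₂ a≢z (λ { refl → All.lookup a∉p b∈ refl }))) l))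
      = a ∷ q , cong (λ v → a ∷ (v ++ [ a ])) w₂≡ , ∉⇒All≢ a∉q ∷ uq , a∷q⊆ , ⊆a∷q
      where
      a∉q : a ∉ q
      a∉q a∈ with q⊆ a∈
      ... | here a≡z  = a≢z a≡z
      ... | there a∈p = All.lookup a∉p a∈p refl
      a∷q⊆ : a ∷ q ⊆ z ∷ a ∷ p
      a∷q⊆ (here e) = there (here e)
      a∷q⊆ (there x∈) with q⊆ x∈
      ... | here e    = here e
      ... | there x∈p = there (there x∈p)
      ⊆a∷q : z ∷ a ∷ p ⊆ a ∷ q
      ⊆a∷q (here e)           = there (⊆q (here e))
      ⊆a∷q (there (here e))   = here e
      ⊆a∷q (there (there x∈)) = there (⊆q (there x∈))
    -- Every other distribution of the two z's makes z z adjacent next to c, or z alternate with a.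
    wrapped 2 0 0 _ _ alt _ = ⊥-elim (¬linked-repeat [] _ (subst (Linked _≢_) (W-center 2 0) alt))
    wrapped 0 0 2 _ _ alt _ = ⊥-elim (¬linked-repeat (restrict z c w₂) [] (subst (Linked _≢_) (W-center 0 2) alt))
    wrapped 1 1 0 m≡ _ _ nonalt = ⊥-elim (nonalt (here refl) (subst (Linked _≢_)
      (sym (trans (W-a 1 0) (cong (λ j → z ∷ a ∷ (replicate j z ++ [ a ])) (sym m≡)))) (z≢a ∷ a≢z ∷ z≢a ∷ [-])))
    wrapped 0 1 1 m≡ _ _ nonalt = ⊥-elim (nonalt (here refl) (subst (Linked _≢_)
      (sym (trans (W-a 0 1) (cong (λ j → a ∷ (replicate j z ++ a ∷ z ∷ [])) (sym m≡)))) (a≢z ∷ z≢a ∷ a≢z ∷ [-])))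

  -- Re-inserting a doubled leaf z into a bordered nested word: since z does not alternate with
  -- the border leaf b, both copies of z stay on the nested side of b.
  module _ (z b : Fin n) (p : Word n) (z≢c : z ≢ c) (z≢b : z ≢ b) (b≢c : b ≢ c)
           (b∉p : b ∉ p) (z∉p : z ∉ p) (c∉p : c ∉ p) (up : Unique p) where
    private
      b≢z : b ≢ z
      b≢z = ≢-sym z≢b

      b≢ : ∀ {a} → a ∈ p → b ≢ a
      b≢ a∈ refl = b∉p a∈

      b∉ : ∀ {v} → erase z v ≡ nest p → b ∉ erase z v
      b∉ e b∈ with ∈nest⇒ p (subst (b ∈_) e b∈)
      ... | inj₁ b≡c = b≢c b≡c
      ... | inj₂ b∈p = b∉p b∈p

    insert-border₁ : ∀ w → erase z w ≡ b ∷ nest p → occ z w ≡ 2 → Alternate z c w → ¬ Alternate z b w →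
      (∀ {a} → a ∈ p → ¬ Alternate z a w) → Σ (Word n) λ q → w ≡ b ∷ nest q × Insertion z p q
    insert-border₁ w e twice alt ¬alt-b nonalt
      with k , w₁ , refl , e₁ ← erase≡∷ z b (nest p) w e
      = bordered k (occ z w₁) refl (trans (sym (occ-padˡ z b k w₁ b≢z)) twice) alt ¬alt-b nonalt
      where
      W : ℕ → Word n
      W k = replicate k z ++ b ∷ w₁
      W-center : ∀ k → restrict z c (W k) ≡ replicate k z ++ restrict z c w₁
      W-center k = trans (restrict-padˡ z c k _) (cong (replicate k z ++_) (restrict-≢ w₁ b≢z b≢c))
      W-b : ∀ k → restrict z b (W k) ≡ replicate k z ++ b ∷ replicate (occ z w₁) z
      W-b k = trans (restrict-padˡ z b k _) (cong (replicate k z ++_)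
        (trans (restrict-≡ʳ z b w₁) (cong (b ∷_) (restrict-only z b w₁ (b∉ {w₁} e₁)))))
      bordered : ∀ k m → m ≡ occ z w₁ → k + m ≡ 2 → Alternate z c (W k) → ¬ Alternate z b (W k) →
        (∀ {a} → a ∈ p → ¬ Alternate z a (W k)) → Σ (Word n) λ q → W k ≡ b ∷ nest q × Insertion z p q
      bordered 0 m m≡ m≡2 alt _ nonalt
        with q , w₁≡ , ins ← insert-nest z p w₁ z≢c z∉p c∉p up e₁ (trans (sym m≡) m≡2)
               (subst (Linked _≢_) (restrict-≢ w₁ b≢z b≢c) alt)
               (λ a∈ l → nonalt a∈ (subst (Linked _≢_) (sym (restrict-≢ w₁ b≢z (b≢ a∈))) l))
        = q , cong (b ∷_) w₁≡ , ins
      bordered 1 1 m≡ _ _ ¬alt-b _ = ⊥-elim (¬alt-b (subst (Linked _≢_)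
        (sym (trans (W-b 1) (cong (λ j → z ∷ b ∷ replicate j z) (sym m≡)))) (z≢b ∷ b≢z ∷ [-])))
      bordered 2 0 _ _ alt _ _ = ⊥-elim (¬linked-repeat [] _ (subst (Linked _≢_) (W-center 2) alt))

    insert-border₂ : ∀ w → erase z w ≡ nest p ++ [ b ] → occ z w ≡ 2 → Alternate z c w → ¬ Alternate z b w →
      (∀ {a} → a ∈ p → ¬ Alternate z a w) → Σ (Word n) λ q → w ≡ nest q ++ [ b ] × Insertion z p q
    insert-border₂ w e twice alt ¬alt-b nonalt
      with w₁ , k , refl , e₁ ← erase≡∷ʳ z b (nest p) w e
      = bordered k (occ z w₁) refl (trans (+-comm k _) (trans (sym (occ-padʳ z b w₁ k b≢z)) twice)) alt ¬alt-b nonalt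
      where
      W : ℕ → Word n
      W k = w₁ ++ b ∷ replicate k z
      W-center : ∀ k → restrict z c (W k) ≡ restrict z c w₁ ++ replicate k z
      W-center k = trans (restrict-++ z c w₁ _) (cong (restrict z c w₁ ++_)
        (trans (restrict-≢ _ b≢z b≢c) (restrict-replicate z c k)))
      W-b : ∀ k → restrict z b (W k) ≡ replicate (occ z w₁) z ++ b ∷ replicate k z
      W-b k = trans (restrict-++ z b w₁ _) (cong₂ _++_ (restrict-only z b w₁ (b∉ {w₁} e₁))
        (trans (restrict-≡ʳ z b _) (cong (b ∷_) (restrict-replicate z b k))))
      bordered : ∀ k m → m ≡ occ z w₁ → k + m ≡ 2 → Alternate z c (W k) → ¬ Alternate z b (W k) →
        (∀ {a} → a ∈ p → ¬ Alternate z a (W k)) → Σ (Word n) λ q → W k ≡ nest q ++ [ b ] × Insertion z p q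
      bordered 0 m m≡ m≡2 alt _ nonalt
        with q , w₁≡ , ins ← insert-nest z p w₁ z≢c z∉p c∉p up e₁ (trans (sym m≡) m≡2)
               (subst (Linked _≢_) (trans (W-center 0) (++-identityʳ _)) alt)
               (λ a∈ l → nonalt a∈ (subst (Linked _≢_)
                  (sym (trans (restrict-++ z _ w₁ [ b ]) (trans (cong (_ ++_) (restrict-≢ [] b≢z (b≢ a∈))) (++-identityʳ _)))) l))
        = q , cong (_++ [ b ]) w₁≡ , ins
      bordered 1 1 m≡ _ _ ¬alt-b _ = ⊥-elim (¬alt-b (subst (Linked _≢_)
        (sym (trans (W-b 1) (cong (λ j → replicate j z ++ b ∷ z ∷ []) (sym m≡)))) (z≢b ∷ b≢z ∷ [-])))
      bordered 2 0 _ _ alt _ _ = ⊥-elim (¬linked-repeat (restrict z c w₁) [] (subst (Linked _≢_) (W-center 2) alt))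

  -- Erasing a doubled leaf z leaves a shortest star word over the other leaves (so z occurs
  -- exactly twice), which has a shape by induction; z is then re-inserted.
  shortest-shape : ∀ m L w → length L ≡ suc m → StarWord L w → length w ≡ suc m + suc m → Shape L w
  shortest-shape zero (x ∷ []) (u₁ ∷ u₂ ∷ []) refl st _ with center∈word st | leaves⊆word st (here refl)
  ... | here refl         | here refl         = ⊥-elim (center∉leaves st (here refl))
  ... | here refl         | there (here refl) = x , [] , [] ∷ [] , (id , id) , inj₂ refl
  ... | there (here refl) | here refl         = x , [] , [] ∷ [] , (id , id) , inj₁ refl
  ... | there (here refl) | there (here refl) = ⊥-elim (center∉leaves st (here refl))
  shortest-shape (suc m) (x ∷ y ∷ L) w len st len-w =
    grow (shortest-shape m rest (erase z w) rest-len rest-star (proj₁ tight))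
    where
    open Reduction (reduce x y L w st)
    rest-len : length rest ≡ suc m
    rest-len = suc-injective (trans rest-length len)
    -- length w = |erase z w| + occ z w with |erase z w| ≥ 2(m + 1) and occ z w ≥ 2 forces equality.
    tight : length (erase z w) ≡ suc m + suc m × occ z w ≡ 2
    tight = double-tight _ _ _ (trans (sym (length-erase-occ z w)) (trans len-w (double-suc (suc m))))
              (star-length (suc m) rest (erase z w) rest-len rest-star) z-twice
    L₀ = x ∷ y ∷ L
    leaf≢c : ∀ {v} → v ∈ L₀ → v ≢ c
    leaf≢c v∈ refl = center∉leaves st v∈
    grow : Shape rest (erase z w) → Shape L₀ w
    grow (b , p , u , (bp⊆rest , rest⊆bp) , border) = reinsert border
      where
      b∈rest : b ∈ rest
      b∈rest = bp⊆rest (here refl)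
      p⊆rest : p ⊆ rest
      p⊆rest = bp⊆rest ∘ there
      z≢b : z ≢ b
      z≢b = ≢-sym (rest≢z b∈rest)
      z∉p : z ∉ p
      z∉p z∈p = rest≢z (p⊆rest z∈p) refl
      c∉p : c ∉ p
      c∉p c∈p = leaf≢c (rest⊆L (p⊆rest c∈p)) refl
      nonalt : ∀ {a} → a ∈ p → ¬ Alternate z a w
      nonalt a∈ = leaves-nonalternating st z∈L (rest⊆L (p⊆rest a∈)) (λ z≡a → rest≢z (p⊆rest a∈) (sym z≡a))
      extend : ∀ {q} → Insertion z p q → Unique (b ∷ q) × SameSet (b ∷ q) L₀
      extend {q} (uq , q⊆ , ⊆q) = ∉⇒All≢ b∉q ∷ uq , bq⊆ , ⊆bq
        where
        b∉q : b ∉ q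
        b∉q b∈ with q⊆ b∈
        ... | here b≡z  = z≢b (sym b≡z)
        ... | there b∈p = Unique[x∷xs]⇒x∉xs u b∈p
        bq⊆ : b ∷ q ⊆ L₀
        bq⊆ (here e) = rest⊆L (bp⊆rest (here e))
        bq⊆ (there v∈) with q⊆ v∈
        ... | here refl = z∈L
        ... | there v∈p = rest⊆L (p⊆rest v∈p)
        ⊆bq : L₀ ⊆ b ∷ q
        ⊆bq v∈ with L⊆z∷rest v∈
        ... | here e = there (⊆q (here e))
        ... | there v∈rest with rest⊆bp v∈rest
        ...   | here e    = here e
        ...   | there v∈p = there (⊆q (there v∈p))
      reinsert : Bordered b p (erase z w) → Shape L₀ w
      reinsert (inj₁ e)
        with q , w≡ , ins ← insert-border₁ z b p (leaf≢c z∈L) z≢b (leaf≢c (rest⊆L b∈rest))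
                              (Unique[x∷xs]⇒x∉xs u) z∉p c∉p (AllPairs.tail u) w e (proj₂ tight)
                              (leaf-alternates st z∈L) (leaves-nonalternating st z∈L (rest⊆L b∈rest) z≢b) nonalt
        = b , q , proj₁ (extend ins) , proj₂ (extend ins) , inj₁ w≡
      reinsert (inj₂ e)
        with q , w≡ , ins ← insert-border₂ z b p (leaf≢c z∈L) z≢b (leaf≢c (rest⊆L b∈rest))
                              (Unique[x∷xs]⇒x∉xs u) z∉p c∉p (AllPairs.tail u) w e (proj₂ tight)
                              (leaf-alternates st z∈L) (leaves-nonalternating st z∈L (rest⊆L b∈rest) z≢b) nonalt
        = b , q , proj₁ (extend ins) , proj₂ (extend ins) , inj₂ w≡

unique-concatMap : ∀ {A B : Set} (f : A → List B) l → Unique l → (∀ {a} → a ∈ l → Unique (f a)) →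
  (∀ {a a′ v} → a ∈ l → a′ ∈ l → v ∈ f a → v ∈ f a′ → a ≡ a′) → Unique (concatMap f l)
unique-concatMap f []      _          _      _        = []
unique-concatMap f (a ∷ l) (a∉ ∷ ul) unique disjoint =
  ++⁺ (unique (here refl)) (unique-concatMap f l ul (unique ∘ there) (λ a∈ a′∈ → disjoint (there a∈) (there a′∈)))
      (λ (v∈fa , v∈rest) → let a′ , a′∈ , v∈fa′ = find (∈-concatMap⁻ f {xs = l} v∈rest)
                           in All.lookup a∉ a′∈ (disjoint (here refl) (there a′∈) v∈fa v∈fa′))

length-concatMap : ∀ {A B : Set} (f : A → List B) l K → (∀ {a} → a ∈ l → length (f a) ≡ K) →
  length (concatMap f l) ≡ length l * K
length-concatMap f []      K _   = refl
length-concatMap f (a ∷ l) K len =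
  trans (length-++ (f a)) (cong₂ _+_ (len (here refl)) (length-concatMap f l K (len ∘ there)))

module Arrangements {A : Set} where

  select : List A → List (A × List A)
  select []       = []
  select (x ∷ xs) = (x , xs) ∷ map (λ (y , ys) → y , x ∷ ys) (select xs)

  arrangements : ℕ → List A → List (List A)
  starting-with : ℕ → A × List A → List (List A)
  arrangements zero    _  = [ [] ]
  arrangements (suc m) xs = concatMap (starting-with m) (select xs)
  starting-with m (y , ys) = map (y ∷_) (arrangements m ys)

  Arrangement : List A → List A → Set
  Arrangement xs q = Unique q × SameSet q xs

  select-firsts : ∀ xs → map proj₁ (select xs) ≡ xs
  select-firsts []       = refl
  select-firsts (x ∷ xs) = cong (x ∷_) (trans (sym (map-∘ (select xs))) (select-firsts xs))

  select-same : ∀ {y ys} xs → (y , ys) ∈ select xs → SameSet xs (y ∷ ys)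
  select-same (x ∷ xs) (here refl) = id , id
  select-same (x ∷ xs) (there s∈)
    with (y , ys) , s∈′ , refl ← ∈-map⁻ _ s∈
    with xs⊆ , ⊆xs ← select-same xs s∈′ =
    (λ { (here e) → there (here e) ; (there v∈) → swap (xs⊆ v∈) }) ,
    (λ { (here e) → there (⊆xs (here e)) ; (there (here e)) → here e ; (there (there v∈)) → there (⊆xs (there v∈)) })
    where
    swap : ∀ {v} → v ∈ y ∷ ys → v ∈ y ∷ x ∷ ys
    swap (here e)  = here e
    swap (there v∈) = there (there v∈)

  select-length : ∀ {y ys} xs → (y , ys) ∈ select xs → length xs ≡ suc (length ys)
  select-length (x ∷ xs) (here refl) = refl
  select-length (x ∷ xs) (there s∈) with _ , s∈′ , refl ← ∈-map⁻ _ s∈ = cong suc (select-length xs s∈′)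

  select-unique : ∀ {y ys} xs → Unique xs → (y , ys) ∈ select xs → Unique (y ∷ ys)
  select-unique (x ∷ xs) u (here refl) = u
  select-unique (x ∷ xs) (x∉ ∷ u) (there s∈)
    with (y , ys) , s∈′ , refl ← ∈-map⁻ _ s∈
    with y∉ys ∷ uys ← select-unique xs u s∈′ =
    ((λ { refl → All.lookup x∉ (proj₂ (select-same xs s∈′) (here refl)) refl }) ∷ y∉ys) ∷
    (∉⇒All≢ (λ x∈ → All.lookup x∉ (proj₂ (select-same xs s∈′) (there x∈)) refl) ∷ uys)

  select-complete : ∀ {y} xs → y ∈ xs → Σ (List A) λ ys → (y , ys) ∈ select xs
  select-complete (x ∷ xs) (here refl) = xs , here refl
  select-complete (x ∷ xs) (there y∈) =
    let ys , s∈ = select-complete xs y∈ in x ∷ ys , there (∈-map⁺ _ s∈)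

  select-functional : ∀ {y ys ys′} xs → Unique xs → (y , ys) ∈ select xs → (y , ys′) ∈ select xs → ys ≡ ys′
  select-functional (x ∷ xs) _ (here refl) (here refl) = refl
  select-functional (x ∷ xs) (x∉ ∷ _) (here refl) (there s∈) with _ , s∈′ , refl ← ∈-map⁻ _ s∈ =
    ⊥-elim (All.lookup x∉ (proj₂ (select-same xs s∈′) (here refl)) refl)
  select-functional (x ∷ xs) (x∉ ∷ _) (there s∈) (here refl) with _ , s∈′ , refl ← ∈-map⁻ _ s∈ =
    ⊥-elim (All.lookup x∉ (proj₂ (select-same xs s∈′) (here refl)) refl)
  select-functional (x ∷ xs) (_ ∷ u) (there s∈) (there s∈₂)
    with _ , s∈′ , refl ← ∈-map⁻ _ s∈ | _ , s∈₂′ , refl ← ∈-map⁻ _ s∈₂ =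
    cong (x ∷_) (select-functional xs u s∈′ s∈₂′)

  ∈-starting-with : ∀ {m y ys q} → q ∈ starting-with m (y , ys) → Σ (List A) λ q′ → q ≡ y ∷ q′ × q′ ∈ arrangements m ys
  ∈-starting-with q∈ = let q′ , q′∈ , q≡ = ∈-map⁻ _ q∈ in q′ , q≡ , q′∈

  arrangements-length : ∀ m xs → length xs ≡ m → length (arrangements m xs) ≡ m !
  arrangements-length zero    xs _   = refl
  arrangements-length (suc m) xs len =
    trans (length-concatMap (starting-with m) (select xs) (m !) each) (cong (_* m !) selections)
    where
    selections : length (select xs) ≡ suc m
    selections = trans (sym (length-map proj₁ (select xs))) (trans (cong length (select-firsts xs)) len)
    each : ∀ {s} → s ∈ select xs → length (starting-with m s) ≡ m !
    each {y , ys} s∈ = trans (length-map (y ∷_) (arrangements m ys))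
                             (arrangements-length m ys (suc-injective (trans (sym (select-length xs s∈)) len)))

  arrangements-sound : ∀ m xs {q} → Unique xs → length xs ≡ m → q ∈ arrangements m xs →
    Arrangement xs q × length q ≡ m
  arrangements-sound zero    []  _ _   (here refl) = ([] , (λ ()) , (λ ())) , refl
  arrangements-sound (suc m) xs  u len q∈
    with (y , ys) , s∈ , q∈′ ← find (∈-concatMap⁻ (starting-with m) {xs = select xs} q∈)
    with q′ , refl , q′∈ ← ∈-starting-with {m} {y} {ys} q∈′
    with y∉ys ∷ uys ← select-unique xs u s∈
    with ((uq′ , q′⊆ , ⊆q′) , len′) ← arrangements-sound m ys uys (suc-injective (trans (sym (select-length xs s∈)) len)) q′∈
    = (∉⇒All≢ (λ y∈ → All.lookup y∉ys (q′⊆ y∈) refl) ∷ uq′ , yq′⊆ , ⊆yq′) , cong suc len′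
    where
    yq′⊆ : y ∷ q′ ⊆ xs
    yq′⊆ (here e)  = proj₂ (select-same xs s∈) (here e)
    yq′⊆ (there v∈) = proj₂ (select-same xs s∈) (there (q′⊆ v∈))
    ⊆yq′ : xs ⊆ y ∷ q′
    ⊆yq′ v∈ with proj₁ (select-same xs s∈) v∈
    ... | here e    = here e
    ... | there v∈′ = there (⊆q′ v∈′)

  arrangements-complete : ∀ m xs q → Unique xs → length xs ≡ m → Arrangement xs q → q ∈ arrangements m xs
  arrangements-complete zero    []       []      _ _   _                = here refl
  arrangements-complete zero    []       (y ∷ q) _ _   (_ , q⊆ , _)     with () ← q⊆ (here refl)
  arrangements-complete (suc m) (x ∷ xs) []      _ _   (_ , _ , ⊆q)     with () ← ⊆q (here refl)
  arrangements-complete (suc m) xs       (y ∷ q) u len (y∉q ∷ uq , yq⊆ , ⊆yq)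
    with ys , s∈ ← select-complete xs (yq⊆ (here refl))
    with y∉ys ∷ uys ← select-unique xs u s∈
    = ∈-concatMap⁺ (starting-with m) {xs = select xs} (Any.map (λ { refl → ∈-map⁺ (y ∷_) rest∈ }) s∈)
    where
    q⊆ys : q ⊆ ys
    q⊆ys v∈ with proj₁ (select-same xs s∈) (yq⊆ (there v∈))
    ... | here refl = ⊥-elim (All.lookup y∉q v∈ refl)
    ... | there v∈′ = v∈′
    ys⊆q : ys ⊆ q
    ys⊆q v∈ with ⊆yq (proj₂ (select-same xs s∈) (there v∈))
    ... | here refl = ⊥-elim (All.lookup y∉ys v∈ refl)
    ... | there v∈′ = v∈′
    rest∈ : q ∈ arrangements m ys
    rest∈ = arrangements-complete m ys q uys (suc-injective (trans (sym (select-length xs s∈)) len)) (uq , q⊆ys , ys⊆q)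

  arrangements-unique : ∀ m xs → Unique xs → Unique (arrangements m xs)
  arrangements-unique zero    xs _ = [] ∷ []
  arrangements-unique (suc m) xs u =
    unique-concatMap (starting-with m) (select xs) (map⁻ (subst Unique (sym (select-firsts xs)) u)) each disjoint
    where
    each : ∀ {s} → s ∈ select xs → Unique (starting-with m s)
    each {y , ys} s∈ = map⁺ (λ e → proj₂ (∷-injective e)) (arrangements-unique m ys (AllPairs.tail (select-unique xs u s∈)))
    disjoint : ∀ {s s′ v} → s ∈ select xs → s′ ∈ select xs → v ∈ starting-with m s → v ∈ starting-with m s′ → s ≡ s′
    disjoint {y , ys} {y′ , ys′} s∈ s′∈ v∈ v∈′
      with _ , refl , _ ← ∈-starting-with {m} {y} {ys} v∈
      with _ , v≡ , _ ← ∈-starting-with {m} {y′} {ys′} v∈′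
      with refl , _ ← ∷-injective v≡
      = cong (y ,_) (select-functional xs u s∈ s′∈)

-- position p b i is the i-th entry of p ++ [ b ] (for p of length m); it reads a labeling
-- off an arrangement.
position : ∀ {A : Set} (p : List A) (b : A) {m} → Fin (suc m) → A
position []      b         _       = b
position (a ∷ p) b         zero    = a
position (a ∷ p) b {suc m} (suc i) = position p b {m} i

position-last : ∀ {A : Set} (p : List A) b m → length p ≡ m → position p b {m} (fromℕ m) ≡ b
position-last []      b zero    _   = refl
position-last (a ∷ p) b (suc m) len = position-last p b m (suc-injective len)

position-prefix : ∀ {A B : Set} (f : A → B) (p : List A) b m → length p ≡ m →
  tabulate {n = m} (λ i → f (position p b {m} (inject₁ i))) ≡ map f p
position-prefix f []      b zero    _   = refl
position-prefix f (a ∷ p) b (suc m) len = cong (f a ∷_) (position-prefix f p b m (suc-injective len))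

position-∈ : ∀ {A : Set} (p : List A) b {m} (i : Fin (suc m)) → position p b i ∈ b ∷ p
position-∈ []      b         _       = here refl
position-∈ (a ∷ p) b         zero    = there (here refl)
position-∈ (a ∷ p) b {suc m} (suc i) with position-∈ p b i
... | here e  = here e
... | there e = there (there e)

position-injective : ∀ {A : Set} (p : List A) b m → length p ≡ m → Unique (b ∷ p) → ∀ {i i′} →
  position p b {m} i ≡ position p b {m} i′ → i ≡ i′
position-injective []      b zero    _   _ {zero}  {zero}   _ = refl
position-injective (a ∷ p) b (suc m) _   _ {zero}  {zero}   _ = refl
position-injective (a ∷ p) b (suc m) _   u {zero}  {suc i′} e =
  ⊥-elim (head∉ u (subst (_∈ b ∷ p) (sym e) (position-∈ p b i′)))
  where
  head∉ : Unique (b ∷ a ∷ p) → a ∉ b ∷ p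
  head∉ (b∉ ∷ _)      (here a≡b) = All.head b∉ (sym a≡b)
  head∉ (_ ∷ a∉ ∷ _) (there a∈) = All.lookup a∉ a∈ refl
position-injective (a ∷ p) b (suc m) len u {suc i} {zero} e = sym (position-injective (a ∷ p) b (suc m) len u (sym e))
position-injective (a ∷ p) b (suc m) len (b∉ ∷ _ ∷ up) {suc i} {suc i′} e =
  cong suc (position-injective p b m (suc-injective len) (All.tail b∉ ∷ up) e)

strip : ∀ {m} (p : List (Fin (suc m))) → (∀ {y} → y ∈ p → y ≢ zero) → Σ (List (Fin m)) λ p̂ → p ≡ map suc p̂
strip []          _     = [] , refl
strip (zero ∷ p)  ≢zero = ⊥-elim (≢zero (here refl) refl)
strip (suc i ∷ p) ≢zero = let p̂ , p≡ = strip p (≢zero ∘ there) in i ∷ p̂ , cong (suc i ∷_) p≡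

module Star (j : ℕ) where
  open StarWords {suc (suc j)} zero
  open Arrangements {Fin (suc (suc j))}

  Represents : Word (suc (suc j)) → Set
  Represents = WordRepresents (StarEdge (suc j))

  leaves : Word (suc (suc j))
  leaves = map suc (allFin (suc j))

  distinct-leaves : Unique leaves
  distinct-leaves = map⁺ Data.Fin.Properties.suc-injective (allFin⁺ (suc j))

  leaves-length : length leaves ≡ suc j
  leaves-length = trans (length-map suc (allFin (suc j))) (length-tabulate id)

  leaf∈leaves : ∀ i → suc i ∈ leaves
  leaf∈leaves i = ∈-map⁺ suc (∈-allFin i)

  leaf≢center : ∀ {y} → y ∈ leaves → y ≢ zero
  leaf≢center y∈ with _ , _ , refl ← ∈-map⁻ suc y∈ = λ ()

  represents⇒star : ∀ {w} → Represents w → StarWord leaves w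
  represents⇒star {w} (covers , edge⇔alt) = record
    { leaves-unique         = distinct-leaves
    ; center∉leaves         = λ c∈ → leaf≢center c∈ refl
    ; center∈word           = covers zero
    ; leaves⊆word           = λ {x} _ → covers x
    ; leaf-alternates       = λ {x} x∈ → Equivalence.to (edge⇔alt x zero (leaf≢center x∈)) (inj₂ (refl , leaf≢center x∈))
    ; leaves-nonalternating = λ {x} {y} x∈ y∈ x≢y alt → no-edge (Equivalence.from (edge⇔alt x y x≢y) alt) x∈ y∈
    }
    where
    no-edge : ∀ {x y} → StarEdge (suc j) x y → x ∈ leaves → y ∈ leaves → ⊥
    no-edge (inj₁ (x≡c , _)) x∈ _  = leaf≢center x∈ x≡c
    no-edge (inj₂ (y≡c , _)) _  y∈ = leaf≢center y∈ y≡c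

  star⇒represents : ∀ {L w} → StarWord L w → SameSet L leaves → Represents w
  star⇒represents {L} {w} st (_ , leaves⊆L) = covers , edge⇔alt
    where
    covers : ∀ x → x ∈ w
    covers zero    = center∈word st
    covers (suc i) = leaves⊆word st (leaves⊆L (leaf∈leaves i))
    edge⇔alt : ∀ x y → x ≢ y → StarEdge (suc j) x y ⇔ Alternate x y w
    edge⇔alt zero    zero     x≢y = ⊥-elim (x≢y refl)
    edge⇔alt zero    (suc i)  _   = mk⇔ (λ _ → subst (Linked _≢_) (restrict-comm (suc i) zero w)
                                                       (leaf-alternates st (leaves⊆L (leaf∈leaves i))))
                                        (λ _ → inj₁ (refl , λ ()))
    edge⇔alt (suc i) zero     _   = mk⇔ (λ _ → leaf-alternates st (leaves⊆L (leaf∈leaves i))) (λ _ → inj₂ (refl , λ ()))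
    edge⇔alt (suc i) (suc i′) x≢y = mk⇔ (λ { (inj₁ (() , _)) ; (inj₂ (() , _)) })
      (λ alt → ⊥-elim (leaves-nonalternating st (leaves⊆L (leaf∈leaves i)) (leaves⊆L (leaf∈leaves i′)) x≢y alt))

  arrangement-length : ∀ {q} → Arrangement leaves q → length q ≡ suc j
  arrangement-length {q} arr = proj₂ (arrangements-sound (suc j) leaves distinct-leaves leaves-length
    (arrangements-complete (suc j) leaves q distinct-leaves leaves-length arr))

  arrangement-form : ∀ {q} → q ∈ arrangements (suc j) leaves →
    Σ (Fin (suc (suc j))) λ b → Σ (Word (suc (suc j))) λ p → q ≡ b ∷ p × Arrangement leaves (b ∷ p)
  arrangement-form {q} q∈ with arrangements-sound (suc j) leaves distinct-leaves leaves-length q∈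
  arrangement-form {b ∷ p} q∈ | arr , _ = b , p , refl , arr

  ℓ : ℕ
  ℓ = suc j + suc j

  Shortest : Word (suc (suc j)) → Set
  Shortest w = length w ≡ ℓ × Represents w

  length-lower-bound : ∀ w → Represents w → ℓ ≤ length w
  length-lower-bound w rep = star-length (suc j) leaves w leaves-length (represents⇒star rep)

  bordered⇒shortest : ∀ {b p w} → Arrangement leaves (b ∷ p) → Bordered b p w → Shortest w
  bordered⇒shortest {b} {p} {w} (u , same) border =
    trans (bordered-length b p w border) (cong (λ k → k + k) (arrangement-length (u , same))) , represents border
    where
    open NestedStar b p u (λ c∈ → leaf≢center (proj₁ same c∈) refl)
    represents : Bordered b p w → Represents w
    represents (inj₁ refl) = star⇒represents bordered₁-star same
    represents (inj₂ refl) = star⇒represents bordered₂-star same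

  shortest⇒bordered : ∀ {w} → Shortest w → Shape leaves w
  shortest⇒bordered {w} (len , rep) = shortest-shape j leaves w leaves-length (represents⇒star rep) len

  sides-differ : ∀ {b p b′ p′} → Arrangement leaves (b ∷ p) → Arrangement leaves (b′ ∷ p′) →
    b ∷ nest p ≢ nest p′ ++ [ b′ ]
  sides-differ (u , same) (u′ , same′) = bordered-distinct _ _ _ _
    (leaf≢center (proj₁ same (here refl))) (zero∉ same) (Unique[x∷xs]⇒x∉xs u) (zero∉ same′) (AllPairs.tail u′)
    where
    zero∉ : ∀ {b p} → SameSet (b ∷ p) leaves → zero ∉ p
    zero∉ same c∈ = leaf≢center (proj₁ same (there c∈)) refl

  bordered-injective : ∀ {b p b′ p′ w} → Arrangement leaves (b ∷ p) → Arrangement leaves (b′ ∷ p′) →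
    Bordered b p w → Bordered b′ p′ w → b ∷ p ≡ b′ ∷ p′
  bordered-injective {b} {p} {b′} {p′} arr arr′ = compare
    where
    compare : ∀ {w} → Bordered b p w → Bordered b′ p′ w → b ∷ p ≡ b′ ∷ p′
    compare (inj₁ refl) (inj₁ e) with refl , e′ ← ∷-injective e = cong (b ∷_) (nest-injective p p′ e′)
    compare (inj₁ refl) (inj₂ e) = ⊥-elim (sides-differ arr arr′ e)
    compare (inj₂ refl) (inj₁ e) = ⊥-elim (sides-differ arr′ arr (sym e))
    compare (inj₂ refl) (inj₂ e) with e′ , refl ← ∷ʳ-injective (nest p) (nest p′) e = cong (b ∷_) (nest-injective p p′ e′)

  borderings : Word (suc (suc j)) → List (Word (suc (suc j)))
  borderings []      = []
  borderings (b ∷ p) = (b ∷ nest p) ∷ (nest p ++ [ b ]) ∷ []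

  ∈borderings⇒ : ∀ {b p w} → w ∈ borderings (b ∷ p) → Bordered b p w
  ∈borderings⇒ (here e)         = inj₁ e
  ∈borderings⇒ (there (here e)) = inj₂ e

  ⇒∈borderings : ∀ {b p w} → Bordered b p w → w ∈ borderings (b ∷ p)
  ⇒∈borderings (inj₁ e) = here e
  ⇒∈borderings (inj₂ e) = there (here e)

  shortest-words : List (Word (suc (suc j)))
  shortest-words = concatMap borderings (arrangements (suc j) leaves)

  shortest-words-sound : ∀ {w} → w ∈ shortest-words → Shortest w
  shortest-words-sound w∈
    with q , q∈ , w∈q ← find (∈-concatMap⁻ borderings {xs = arrangements (suc j) leaves} w∈)
    with b , p , refl , arr ← arrangement-form q∈
    = bordered⇒shortest arr (∈borderings⇒ w∈q)

  shortest-words-complete : ∀ {w} → Shortest w → w ∈ shortest-words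
  shortest-words-complete sh with b , p , u , same , border ← shortest⇒bordered sh =
    ∈-concatMap⁺ borderings {xs = arrangements (suc j) leaves} (Any.map (λ { refl → ⇒∈borderings border })
      (arrangements-complete (suc j) leaves (b ∷ p) distinct-leaves leaves-length (u , same)))

  shortest-words-unique : Unique shortest-words
  shortest-words-unique = unique-concatMap borderings _ (arrangements-unique (suc j) leaves distinct-leaves) two-sides disjoint
    where
    two-sides : ∀ {q} → q ∈ arrangements (suc j) leaves → Unique (borderings q)
    two-sides q∈ with b , p , refl , arr ← arrangement-form q∈ =
      (sides-differ arr arr ∷ []) ∷ [] ∷ []
    disjoint : ∀ {q q′ v} → q ∈ arrangements (suc j) leaves → q′ ∈ arrangements (suc j) leaves →
      v ∈ borderings q → v ∈ borderings q′ → q ≡ q′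
    disjoint q∈ q′∈ v∈ v∈′
      with _ , _ , refl , arr ← arrangement-form q∈
      with _ , _ , refl , arr′ ← arrangement-form q′∈
      = bordered-injective arr arr′ (∈borderings⇒ v∈) (∈borderings⇒ v∈′)

  shortest-words-length : length shortest-words ≡ 2 * suc j !
  shortest-words-length =
    trans (length-concatMap borderings _ 2 two)
          (trans (cong (_* 2) (arrangements-length (suc j) leaves leaves-length)) (*-comm (suc j !) 2))
    where
    two : ∀ {q} → q ∈ arrangements (suc j) leaves → length (borderings q) ≡ 2
    two q∈ with _ , _ , refl , _ ← arrangement-form q∈ = refl

  labeling : ∀ {b p} → Arrangement leaves (b ∷ p) →
    Σ (Fin (suc j) → Fin (suc j)) λ σ → Injective _≡_ _≡_ σ × lastLeaf j σ ≡ b × leafPrefix j σ ≡ p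
  labeling {b} {p} (u , same) with strip (b ∷ p) (λ v∈ → leaf≢center (proj₁ same v∈))
  ... | b̂ ∷ p̂ , refl =
    position p̂ b̂ , position-injective p̂ b̂ j len̂ (map⁻ u) , cong suc (position-last p̂ b̂ j len̂) ,
    trans (map-tabulate id (λ i → suc (position p̂ b̂ (inject₁ i)))) (position-prefix suc p̂ b̂ j len̂)
    where
    len̂ : length p̂ ≡ j
    len̂ = trans (sym (length-map suc p̂)) (suc-injective (arrangement-length (u , same)))

  bordered⇒forms : ∀ {b p w} σ → lastLeaf j σ ≡ b → leafPrefix j σ ≡ p → Bordered b p w →
    w ≡ form₁ j σ ⊎ w ≡ form₂ j σ
  bordered⇒forms {b} {p} σ last≡ prefix≡ (inj₁ refl) = inj₁ (begin
    b ∷ nest p                                       ≡⟨ cong (b ∷_) (nest-form p) ⟩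
    b ∷ (p ++ zero ∷ reverse p)                      ≡⟨ sym (cong₂ (λ x y → x ∷ (y ++ zero ∷ reverse y)) last≡ prefix≡) ⟩
    form₁ j σ                                        ∎)
    where open ≡-Reasoning
  bordered⇒forms {b} {p} σ last≡ prefix≡ (inj₂ refl) = inj₂ (begin
    nest p ++ [ b ]                                  ≡⟨ cong (_++ [ b ]) (nest-form p) ⟩
    (p ++ zero ∷ reverse p) ++ [ b ]                 ≡⟨ ++-assoc p (zero ∷ reverse p) [ b ] ⟩
    p ++ (zero ∷ reverse p) ++ [ b ]                 ≡⟨ sym (cong₂ (λ x y → y ++ (zero ∷ reverse y) ++ [ x ]) last≡ prefix≡) ⟩
    form₂ j σ                                        ∎)
    where open ≡-Reasoning

  shortest⇒forms : ∀ {w} → Shortest w →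
    Σ (Fin (suc j) → Fin (suc j)) λ σ → Injective _≡_ _≡_ σ × (w ≡ form₁ j σ ⊎ w ≡ form₂ j σ)
  shortest⇒forms sh
    with b , p , u , same , border ← shortest⇒bordered sh
    with σ , σ-injective , last≡ , prefix≡ ← labeling (u , same)
    = σ , σ-injective , bordered⇒forms σ last≡ prefix≡ border

  -- Some word of length ℓ represents S_k: a bordered word of the arrangement leaves itself.
  shortest-exists : Σ (Word (suc (suc j))) Shortest
  shortest-exists = of-arrangement leaves (distinct-leaves , id , id)
    where
    of-arrangement : ∀ q → Arrangement leaves q → Σ (Word (suc (suc j))) Shortest
    of-arrangement []      arr with () ← arrangement-length arr
    of-arrangement (b ∷ p) arr = b ∷ nest p , bordered⇒shortest arr (inj₁ refl)

lemma3 : (j : ℕ) →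
    Σ ℕ λ ℓ →
      IsMinLength (StarEdge (suc j)) ℓ ×
      NumRepresentingWords (StarEdge (suc j)) ℓ (2 * (suc j) !) ×
      (∀ w → length w ≡ ℓ → WordRepresents (StarEdge (suc j)) w →
        Σ (Fin (suc j) → Fin (suc j)) λ σ →
          Injective _≡_ _≡_ σ × (w ≡ form₁ j σ ⊎ w ≡ form₂ j σ))
lemma3 j =
  ℓ ,
  (shortest-exists , length-lower-bound) ,
  (shortest-words , shortest-words-unique , shortest-words-length ,
     λ w → mk⇔ shortest-words-sound shortest-words-complete) ,
  λ w len rep → shortest⇒forms (len , rep)
  where open Star j
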